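{- $r\in\mathrm{Sd}(X\multimap Y)$ iff $\langle r\rangle\big(P_X(x)\big)\subseteq P_Y\big(\langle r\rangle(x)\big)$ for all $x\subseteq|X|$.
   Context: An interface $X$ is $(|X|,P_X)$ with $P_X$ a monotonic predicate transformer on $\mathcal{P}(|X|)$; $\mathrm{Sd}(X)=\{x\mid x\subseteq P_X(x)\}$. $\langle r\rangle(x)=\{b\mid\exists a\,(a,b)\in r\wedge a\in x\}$ for $r\subseteq|X|\times|Y|$. Dual $X^\perp=(|X|,x\mapsto\overline{P_X(\overline{x})})$; tensor on $|X|\times|Y|$ with $r\mapsto\bigcup_{x\times y\subseteq r}P_X(x)\times P_Y(y)$; par $X\mathbin{\text{⅋}}Y=(X^\perp\otimes Y^\perp)^\perp$; $X\multimap Y=X^\perp\mathbin{\text{⅋}}Y$. -}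

module Defs where

import Level
open import Level using (Level; 0ℓ) renaming (suc to lsuc)
open import Data.Product using (Σ; ∃; ∃-syntax; _×_; _,_)
open import Relation.Unary using (Pred; _⊆_; ∁; _∈_)

PT : (a b : Level) → Set → Set (lsuc a Level.⊔ lsuc b)
PT a b A = Pred A a → Pred A b

Monotone : ∀ {a b} {A : Set} → PT a b A → Set (lsuc a Level.⊔ b)
Monotone P = ∀ {x y} → x ⊆ y → P x ⊆ P y

record Interface : Set₁ where
  field
    Carrier : Set
    P       : PT 0ℓ 0ℓ Carrier
    mono    : Monotone P
open Interface public

∣_∣ : Interface → Set
∣ X ∣ = Carrier X

Sd : ∀ {a b} {A : Set} → PT a b A → Pred (Pred A a) (a Level.⊔ b)
Sd P x = x ⊆ P x

⟨_⟩ : {A B : Set} → Pred (A × B) 0ℓ → Pred A 0ℓ → Pred B 0ℓ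
⟨ r ⟩ x b = ∃[ a ] ((a , b) ∈ r × a ∈ x)

dualT : ∀ {a b} {A : Set} → PT a b A → PT a b A
dualT P x = ∁ (P (∁ x))

dual-mono : {A : Set} (P : PT 0ℓ 0ℓ A) → Monotone P → Monotone (dualT P)
dual-mono P m x⊆y nPcx Pcy = nPcx (m (λ ny xz → ny (x⊆y xz)) Pcy)

_^⊥ : Interface → Interface
X ^⊥ = record { Carrier = Carrier X ; P = dualT (P X) ; mono = dual-mono (P X) (mono X) }

_⊠_ : {A B : Set} → Pred A 0ℓ → Pred B 0ℓ → Pred (A × B) 0ℓ
(x ⊠ y) (a , b) = x a × y b

tensorT : {A B : Set} → PT 0ℓ 0ℓ A → PT 0ℓ 0ℓ B → PT 0ℓ (lsuc 0ℓ) (A × B)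
tensorT PX PY r (a , b) =
  Σ (Pred _ 0ℓ) λ x → Σ (Pred _ 0ℓ) λ y → ((x ⊠ y) ⊆ r) × (a ∈ PX x) × (b ∈ PY y)

P⊗ : (X Y : Interface) → PT 0ℓ (lsuc 0ℓ) (∣ X ∣ × ∣ Y ∣)
P⊗ X Y = tensorT (P X) (P Y)

P⅋ : (X Y : Interface) → PT 0ℓ (lsuc 0ℓ) (∣ X ∣ × ∣ Y ∣)
P⅋ X Y = dualT (P⊗ (X ^⊥) (Y ^⊥))

P⊸ : (X Y : Interface) → PT 0ℓ (lsuc 0ℓ) (∣ X ∣ × ∣ Y ∣)
P⊸ X Y = P⅋ (X ^⊥) Y

-- Unfolding the duals, (a , b) ∈ P_{X ⊸ Y} r says: there are no x, y with x × y disjoint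
-- from r, a ∈ P_X x and b ∉ P_Y (∁ y). Disjointness of x × y from r is the Galois
-- connection ⟨ r ⟩ x ⊆ ∁ y, so the largest admissible y is ∁ (⟨ r ⟩ x), and the
-- condition becomes b ∈ ⟨ r ⟩ (P_X x) ⇒ b ∈ P_Y (⟨ r ⟩ x). Classical logic is needed
-- to cancel the double complements.
module Submission where

open import Defs
open import Level using (0ℓ)
open import Data.Product using (_×_; _,_)
open import Relation.Unary using (Pred; _⊆_; ∁)
open import Axiom.ExcludedMiddle using (ExcludedMiddle)
open import Axiom.DoubleNegationElimination using (DoubleNegationElimination; em⇒dne)

module _ {A : Set} where

  ⊆-∁∁ : (x : Pred A 0ℓ) → x ⊆ ∁ (∁ x)
  ⊆-∁∁ _ x∈ x∉ = x∉ x∈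

  dualT-dualT-⊇ : {P : PT 0ℓ 0ℓ A} → Monotone P → ∀ {x} → P x ⊆ dualT (dualT P) x
  dualT-dualT-⊇ {P} mono {x} p = ⊆-∁∁ (P (∁ (∁ x))) (mono (⊆-∁∁ x) p)

  dualT-dualT-⊆ : DoubleNegationElimination 0ℓ →
                  {P : PT 0ℓ 0ℓ A} → Monotone P → ∀ {x} → dualT (dualT P) x ⊆ P x
  dualT-dualT-⊆ dne mono p = mono dne (dne p)

module _ {A B : Set} {r : Pred (A × B) 0ℓ} {x : Pred A 0ℓ} where

  ⊠-⊆-∁⇒⟨⟩-⊆-∁ : {y : Pred B 0ℓ} → (x ⊠ y) ⊆ ∁ r → ⟨ r ⟩ x ⊆ ∁ y
  ⊠-⊆-∁⇒⟨⟩-⊆-∁ disjoint (a , rab , a∈x) b∈y = disjoint (a∈x , b∈y) rab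

  ⟨⟩-⊆-∁⇒⊠-⊆-∁ : {y : Pred B 0ℓ} → ⟨ r ⟩ x ⊆ ∁ y → (x ⊠ y) ⊆ ∁ r
  ⟨⟩-⊆-∁⇒⊠-⊆-∁ image {a , b} (a∈x , b∈y) rab = image (a , rab , a∈x) b∈y

Simulation : (X Y : Interface) → Pred (∣ X ∣ × ∣ Y ∣) 0ℓ → Set₁
Simulation X Y r = ∀ (x : Pred ∣ X ∣ 0ℓ) → ⟨ r ⟩ (P X x) ⊆ P Y (⟨ r ⟩ x)

module _ (dne : DoubleNegationElimination 0ℓ) (X Y : Interface)
         (r : Pred (∣ X ∣ × ∣ Y ∣) 0ℓ) where

  Sd-⊸⇒Simulation : Sd (P⊸ X Y) r → Simulation X Y r
  Sd-⊸⇒Simulation safe x (a , rab , a∈Px) = dne λ b∉P⟨r⟩x →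
    safe rab ( x , ∁ (⟨ r ⟩ x)
             , ⟨⟩-⊆-∁⇒⊠-⊆-∁ {y = ∁ (⟨ r ⟩ x)} (⊆-∁∁ (⟨ r ⟩ x))
             , dualT-dualT-⊇ (mono X) a∈Px
             , λ b∈P∁∁ → b∉P⟨r⟩x (mono Y dne b∈P∁∁) )

  Simulation⇒Sd-⊸ : Simulation X Y r → Sd (P⊸ X Y) r
  Simulation⇒Sd-⊸ simulation rab (x , y , disjoint , a∈Px , b∉P∁y) =
    b∉P∁y (mono Y (⊠-⊆-∁⇒⟨⟩-⊆-∁ {y = y} disjoint)
                  (simulation x (_ , rab , dualT-dualT-⊆ dne (mono X) a∈Px)))

lemma6 : (lem : ∀ {ℓ} → ExcludedMiddle ℓ) (X Y : Interface)
         (r : Pred (∣ X ∣ × ∣ Y ∣) 0ℓ) →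
         (Sd (P⊸ X Y) r → ∀ (x : Pred ∣ X ∣ 0ℓ) → ⟨ r ⟩ (P X x) ⊆ P Y (⟨ r ⟩ x))
         × ((∀ (x : Pred ∣ X ∣ 0ℓ) → ⟨ r ⟩ (P X x) ⊆ P Y (⟨ r ⟩ x)) → Sd (P⊸ X Y) r)
lemma6 lem X Y r = Sd-⊸⇒Simulation dne X Y r , Simulation⇒Sd-⊸ dne X Y r
  where
  dne : DoubleNegationElimination 0ℓ
  dne = em⇒dne lem
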